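{- Let $r\ge 3$ be an integer, let $t\in[0,1)$ and $\delta$ be reals, and let $w\colon E(K_n)\to[0,1]$ be an edge weighting of $K_n$ with minimum weighted degree at least $\delta n$. Then every vertex of $K_n$ lies in at least $\left(1-\frac{1-\delta}{1-t}\right)\binom{n-1}{r-1}$ copies of $K_r$ whose weight is at least $t\binom{r}{2}$.
   Context: The weighted degree of a vertex $v$ under $w$ is the sum of the weights of the edges incident to $v$. The weight of a copy of $K_r$ in $K_n$ is the sum of the weights of its $\binom{r}{2}$ edges.
   Formalization: The parameters t and δ and the edge weights of w are rational numbers instead of reals. -}

module Defs where

open import Data.Bool using (Bool; true; false; if_then_else_; _∧_)
open import Data.Nat as ℕ using (ℕ; zero; suc)
open import Data.Nat.Combinatorics using (_C_)
open import Data.Fin as Fin using (Fin; zero; suc)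
open import Data.Fin.Subset using (Subset; inside; outside; _∈_; ∣_∣)
open import Data.Fin.Subset.Properties using (_∈?_)
open import Data.Vec using ([]; _∷_)
open import Data.List using (List; [_]; _++_; map; filter; length)
open import Data.Product using (_×_; _,_)
open import Data.Rational using (ℚ; 0ℚ; 1ℚ; _+_; _-_; _*_; _÷_; -_; _≤_; _<_; NonZero; >-nonZero)
open import Data.Rational.Properties using (_≤?_; +-monoˡ-<; +-inverseʳ)
open import Data.Integer using (+_)
open import Relation.Nullary using (Dec; does)
open import Relation.Nullary.Decidable using (_×-dec_)
open import Relation.Binary.PropositionalEquality using (_≡_; subst)

ℕtoℚ : ℕ → ℚ
ℕtoℚ k = + k Data.Rational./ 1

sumFin : ∀ {n} → (Fin n → ℚ) → ℚ
sumFin {zero}  f = 0ℚ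
sumFin {suc n} f = f zero + sumFin (λ i → f (suc i))

-- Edge weightings of K_n on vertex set Fin n: a function on ordered pairs that is
-- symmetric and takes values in [0,1] on distinct pairs (values on the diagonal
-- are never used).
Symmetric : ∀ {n} → (Fin n → Fin n → ℚ) → Set
Symmetric {n} w = ∀ (u v : Fin n) → w u v ≡ w v u

InUnitInterval : ∀ {n} → (Fin n → Fin n → ℚ) → Set
InUnitInterval {n} w = ∀ (u v : Fin n) → (u ≡ v → Data.Empty.⊥) → (0ℚ ≤ w u v) × (w u v ≤ 1ℚ)
  where import Data.Empty

wdeg : ∀ {n} → (Fin n → Fin n → ℚ) → Fin n → ℚ
wdeg w v = sumFin (λ u → if does (u Fin.≟ v) then 0ℚ else w v u)

cliqueWeight : ∀ {n} → (Fin n → Fin n → ℚ) → Subset n → ℚ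
cliqueWeight w S = sumFin (λ i → sumFin (λ j →
  if does (i Fin.<? j) ∧ does (i ∈? S) ∧ does (j ∈? S) then w i j else 0ℚ))

allSubsets : ∀ n → List (Subset n)
allSubsets zero    = [ [] ]
allSubsets (suc n) = map (inside ∷_) (allSubsets n) ++ map (outside ∷_) (allSubsets n)

HeavyCliqueAt : ∀ {n} → ℕ → ℚ → (Fin n → Fin n → ℚ) → Fin n → Subset n → Set
HeavyCliqueAt r t w v S = (∣ S ∣ ≡ r) × (v ∈ S) × (t * ℕtoℚ (r C 2) ≤ cliqueWeight w S)

heavyCliqueAt? : ∀ {n} r t (w : Fin n → Fin n → ℚ) v S → Dec (HeavyCliqueAt r t w v S)
heavyCliqueAt? r t w v S =
  (∣ S ∣ ℕ.≟ r) ×-dec ((v ∈? S) ×-dec (t * ℕtoℚ (r C 2) ≤? cliqueWeight w S))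

numHeavyCliquesAt : ∀ n → ℕ → ℚ → (Fin n → Fin n → ℚ) → Fin n → ℕ
numHeavyCliquesAt n r t w v = length (filter (heavyCliqueAt? r t w v) (allSubsets n))

1-t-nonZero : ∀ {t} → t < 1ℚ → NonZero (1ℚ - t)
1-t-nonZero {t} t<1 = >-nonZero (subst (_< 1ℚ - t) (+-inverseʳ t) (+-monoˡ-< (- t) t<1))

factor : (t δ : ℚ) → t < 1ℚ → ℚ
factor t δ t<1 = 1ℚ - ((1ℚ - δ) ÷ (1ℚ - t)) {{1-t-nonZero t<1}}

{-# OPTIONS --safe #-}
-- Fix v and count the r-sets S ∋ v: h of them are heavy (weight ≥ t·C(r,2)) and l light,
-- h + l = C(n-1,r-1). Double counting the edges inside these sets,
--   2 Σ_S w(S) = C(n-3,r-3) Σ_u deg(u) + 2 (C(n-2,r-2) - C(n-3,r-3)) deg(v),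
-- and the degree condition turns this into Σ_S w(S) ≥ δ C(r,2) C(n-1,r-1) for δ ≥ 0 (binomial
-- absorption identities do the bookkeeping). A heavy set weighs at most C(r,2), a light one
-- less than t·C(r,2), so δ (h + l) ≤ h + t l, i.e. (1 - t) h ≥ (δ - t)(h + l).

module Submission where

open import Defs
open import Data.Nat using (ℕ; _∸_)
open import Data.Nat.Combinatorics using (_C_)
open import Data.Fin using (Fin)
open import Data.Rational using (ℚ; 0ℚ; 1ℚ; _*_; _≤_; _<_)
open import Level using (0ℓ)
open import Function using (_∘_; mk⇔)
open import Data.Bool using (Bool; true; false; if_then_else_; _∧_; not)
import Data.Bool.Properties as 𝔹
open import Data.Empty using (⊥-elim)
open import Data.Sum using (inj₁; inj₂) renaming ([_,_] to either)
open import Data.Product using (_×_; _,_; proj₂)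
import Data.Integer as ℤ
import Data.Integer.Properties as ℤ
open import Data.List as List using (List; []; _∷_; map; filter; length; _++_)
import Data.List.Properties as List
open import Data.Nat as ℕ using (zero; suc; s≤s; z≤n)
import Data.Nat.Properties as ℕ
import Data.Nat.Coprimality as Coprimality
open import Data.Nat.Combinatorics using (nCk+nC[k+1]≡[n+1]C[k+1]; nC1≡n)
import Data.Nat.Tactic.RingSolver as ℕ-Ring
open import Data.Fin as Fin using (zero; suc)
import Data.Fin.Properties as Fin
open import Data.Fin.Subset using (Subset; inside; outside; ∣_∣; _∈_; _∉_; _⊆_; ⁅_⁆; _∪_)
open import Data.Fin.Subset.Properties
  using (_∈?_; _⊆?_; ∣p∣≤n; ∣⁅x⁆∣≡1; x∈⁅x⁆; x∈⁅y⁆⇒x≡y; x≢y⇒x∉⁅y⁆; ∪-identityˡ; p⊆p∪q; q⊆p∪q; x∈p∪q⁺; x∈p∪q⁻)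
open import Data.Vec using ([]; _∷_; here; there)
open import Data.Rational as ℚ using (mkℚ; ½; _+_; _-_; -_; 1/_)
import Data.Rational.Properties as ℚ
open import Relation.Nullary using (Dec; yes; no; does; ¬_)
open import Relation.Nullary.Decidable using (does-⇔; _×-dec_; dec-true; dec-false; dec⇒maybe)
open import Relation.Unary using (Decidable)
open import Relation.Binary using (tri<; tri≈; tri>)
open import Relation.Binary.PropositionalEquality
open import Tactic.RingSolver using (solve-∀)
open import Tactic.RingSolver.Core.AlmostCommutativeRing using (AlmostCommutativeRing; fromCommutativeRing)

-- Rational arithmetic

-- The zero test lets the solver evaluate numeric constants such as 1ℚ + 0ℚ.
ℚ-ring : AlmostCommutativeRing 0ℓ 0ℓ
ℚ-ring = fromCommutativeRing ℚ.+-*-commutativeRing (λ x → dec⇒maybe (0ℚ ℚ.≟ x))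

+-interchange : ∀ a b c d → (a + b) + (c + d) ≡ (a + c) + (b + d)
+-interchange = solve-∀ ℚ-ring

p≤q⇒0≤q-p : ∀ {p q} → p ≤ q → 0ℚ ≤ q - p
p≤q⇒0≤q-p {p} {q} p≤q = subst (_≤ q - p) (ℚ.+-inverseʳ p) (ℚ.+-monoˡ-≤ (- p) p≤q)

0≤q⇒p≤p+q : ∀ {p q} → 0ℚ ≤ q → p ≤ p + q
0≤q⇒p≤p+q {p} {q} 0≤q = subst (_≤ p + q) (ℚ.+-identityʳ p) (ℚ.+-monoʳ-≤ p 0≤q)

0≤p*q : ∀ {p q} → 0ℚ ≤ p → 0ℚ ≤ q → 0ℚ ≤ p * q
0≤p*q {p} {q} 0≤p 0≤q = subst (_≤ p * q) (ℚ.*-zeroʳ p) (ℚ.*-monoˡ-≤-nonNeg p {{ℚ.nonNegative 0≤p}} 0≤q)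

p+p≤q+q⇒p≤q : ∀ {p q} → p + p ≤ q + q → p ≤ q
p+p≤q+q⇒p≤q {p} {q} p+p≤q+q = subst₂ _≤_ (halve p) (halve q) (ℚ.*-monoˡ-≤-nonNeg ½ p+p≤q+q)
  where
  halve : ∀ x → ½ * (x + x) ≡ x
  halve = solve-∀ ℚ-ring

private
  1-coprime : ∀ k → Coprimality.Coprime k 1
  1-coprime k = Coprimality.sym (Coprimality.1-coprimeTo k)

ℕtoℚ-normal : ∀ k → ℕtoℚ k ≡ mkℚ (ℤ.+ k) 0 (1-coprime k)
ℕtoℚ-normal k = ℚ.normalize-coprime (1-coprime k)

ℕtoℚ-+ : ∀ a b → ℕtoℚ (a ℕ.+ b) ≡ ℕtoℚ a + ℕtoℚ b
ℕtoℚ-+ a b = begin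
  ℕtoℚ (a ℕ.+ b)
    ≡⟨ cong (ℚ._/ 1) (cong₂ ℤ._+_ (ℤ.*-identityʳ (ℤ.+ a)) (ℤ.*-identityʳ (ℤ.+ b))) ⟨
  (ℤ.+ a ℤ.* ℤ.+ 1 ℤ.+ ℤ.+ b ℤ.* ℤ.+ 1) ℚ./ 1
    ≡⟨ cong₂ _+_ (ℕtoℚ-normal a) (ℕtoℚ-normal b) ⟨
  ℕtoℚ a + ℕtoℚ b ∎
  where open ≡-Reasoning

ℕtoℚ-* : ∀ a b → ℕtoℚ (a ℕ.* b) ≡ ℕtoℚ a * ℕtoℚ b
ℕtoℚ-* a b = begin
  ℕtoℚ (a ℕ.* b)            ≡⟨ cong (ℚ._/ 1) (ℤ.pos-* a b) ⟩
  (ℤ.+ a ℤ.* ℤ.+ b) ℚ./ 1   ≡⟨ cong₂ _*_ (ℕtoℚ-normal a) (ℕtoℚ-normal b) ⟨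
  ℕtoℚ a * ℕtoℚ b           ∎
  where open ≡-Reasoning

ℕtoℚ-mono-≤ : ∀ {a b} → a ℕ.≤ b → ℕtoℚ a ≤ ℕtoℚ b
ℕtoℚ-mono-≤ {a} {b} a≤b = subst₂ _≤_ (sym (ℕtoℚ-normal a)) (sym (ℕtoℚ-normal b))
  (ℚ.*≤* (subst₂ ℤ._≤_ (sym (ℤ.*-identityʳ (ℤ.+ a))) (sym (ℤ.*-identityʳ (ℤ.+ b))) (ℤ.+≤+ a≤b)))

ℕtoℚ-nonNeg : ∀ a → 0ℚ ≤ ℕtoℚ a
ℕtoℚ-nonNeg a = ℕtoℚ-mono-≤ {0} {a} z≤n

p*0≤ℕtoℚ : ∀ p c → p * 0ℚ ≤ ℕtoℚ c
p*0≤ℕtoℚ p c = subst (_≤ ℕtoℚ c) (sym (ℚ.*-zeroʳ p)) (ℕtoℚ-nonNeg c)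

factor*-≤ : ∀ {t δ h l} (t<1 : t < 1ℚ) → δ * (h + l) ≤ h + t * l → factor t δ t<1 * (h + l) ≤ h
factor*-≤ {t} {δ} {h} {l} t<1 δ-bound = ℚ.*-cancelˡ-≤-pos (1ℚ - t) {{ℚ.positive 0<1-t}} (begin
  -- factor t δ t<1 unfolds to 1ℚ - (1ℚ - δ) * u
  (1ℚ - t) * ((1ℚ - (1ℚ - δ) * u) * (h + l))
    ≡⟨ expand t δ u (h + l) ⟩
  ((1ℚ - t) - (1ℚ - δ) * ((1ℚ - t) * u)) * (h + l)
    ≡⟨ cong (λ x → ((1ℚ - t) - (1ℚ - δ) * x) * (h + l)) (ℚ.*-inverseʳ (1ℚ - t) {{1-t-nonZero t<1}}) ⟩
  ((1ℚ - t) - (1ℚ - δ) * 1ℚ) * (h + l)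
    ≡⟨ simplify t δ (h + l) ⟩
  δ * (h + l) - t * (h + l)
    ≤⟨ ℚ.+-monoˡ-≤ (- (t * (h + l))) δ-bound ⟩
  h + t * l - t * (h + l)
    ≡⟨ collect t h l ⟩
  (1ℚ - t) * h ∎)
  where
  open ℚ.≤-Reasoning
  u : ℚ
  u = (1/ (1ℚ - t)) {{1-t-nonZero t<1}}
  0<1-t : 0ℚ < 1ℚ - t
  0<1-t = subst (_< 1ℚ - t) (ℚ.+-inverseʳ t) (ℚ.+-monoˡ-< (- t) t<1)
  expand : ∀ t δ u x → (1ℚ - t) * ((1ℚ - (1ℚ - δ) * u) * x) ≡ ((1ℚ - t) - (1ℚ - δ) * ((1ℚ - t) * u)) * x
  expand = solve-∀ ℚ-ring
  simplify : ∀ t δ x → ((1ℚ - t) - (1ℚ - δ) * 1ℚ) * x ≡ δ * x - t * x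
  simplify = solve-∀ ℚ-ring
  collect : ∀ t h l → h + t * l - t * (h + l) ≡ (1ℚ - t) * h
  collect = solve-∀ ℚ-ring

-- Indicators and finite sums

𝟙 : Bool → ℚ
𝟙 true  = 1ℚ
𝟙 false = 0ℚ

𝟙-∧ : ∀ a b → 𝟙 (a ∧ b) ≡ 𝟙 a * 𝟙 b
𝟙-∧ true  b = sym (ℚ.*-identityˡ (𝟙 b))
𝟙-∧ false b = sym (ℚ.*-zeroˡ (𝟙 b))

𝟙-split : ∀ a b → 𝟙 a ≡ 𝟙 (a ∧ b) + 𝟙 (a ∧ not b)
𝟙-split true  true  = sym (ℚ.+-identityʳ 1ℚ)
𝟙-split true  false = sym (ℚ.+-identityˡ 1ℚ)
𝟙-split false b     = refl

𝟙*≡if : ∀ b x → 𝟙 b * x ≡ (if b then x else 0ℚ)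
𝟙*≡if true  x = ℚ.*-identityˡ x
𝟙*≡if false x = ℚ.*-zeroˡ x

𝟙-nonNeg : ∀ b → 0ℚ ≤ 𝟙 b
𝟙-nonNeg true  = ℚ.<⇒≤ (ℚ.positive⁻¹ 1ℚ)
𝟙-nonNeg false = ℚ.≤-refl

private
  vanish : ∀ f u u′ → 0ℚ * f ≡ u * 0ℚ + u′ * 0ℚ
  vanish = solve-∀ ℚ-ring
  pick₁ : ∀ u u′ → u * 1ℚ + u′ * 0ℚ ≡ u
  pick₁ = solve-∀ ℚ-ring
  pick₂ : ∀ u u′ → u * 0ℚ + u′ * 1ℚ ≡ u′
  pick₂ = solve-∀ ℚ-ring

𝟙*-≤-split : ∀ {A C : Set} (a? : Dec A) b (c? : Dec C) {f u u′ : ℚ} → (A → f ≤ u) → (¬ C → f ≤ u′) →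
  𝟙 (does a? ∧ b) * f ≤ u * 𝟙 ((does a? ∧ b) ∧ does c?) + u′ * 𝟙 ((does a? ∧ b) ∧ not (does c?))
𝟙*-≤-split (no _)  _     _       {f} {u} {u′} _   _    = ℚ.≤-reflexive (vanish f u u′)
𝟙*-≤-split (yes _) false _       {f} {u} {u′} _   _    = ℚ.≤-reflexive (vanish f u u′)
𝟙*-≤-split (yes a) true  (yes _) {f} {u} {u′} f≤u _    = subst₂ _≤_ (sym (ℚ.*-identityˡ f)) (sym (pick₁ u u′)) (f≤u a)
𝟙*-≤-split (yes _) true  (no ¬c) {f} {u} {u′} _   f≤u′ = subst₂ _≤_ (sym (ℚ.*-identityˡ f)) (sym (pick₂ u u′)) (f≤u′ ¬c)

sumFin-cong : ∀ {n} {f g : Fin n → ℚ} → (∀ i → f i ≡ g i) → sumFin f ≡ sumFin g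
sumFin-cong {zero}  f≡g = refl
sumFin-cong {suc n} f≡g = cong₂ _+_ (f≡g zero) (sumFin-cong (f≡g ∘ suc))

sumFin-0 : ∀ n → sumFin {n} (λ _ → 0ℚ) ≡ 0ℚ
sumFin-0 zero    = refl
sumFin-0 (suc n) = trans (cong (0ℚ +_) (sumFin-0 n)) (ℚ.+-identityˡ 0ℚ)

sumFin-+ : ∀ {n} (f g : Fin n → ℚ) → sumFin (λ i → f i + g i) ≡ sumFin f + sumFin g
sumFin-+ {zero}  f g = sym (ℚ.+-identityˡ 0ℚ)
sumFin-+ {suc n} f g = begin
  (f zero + g zero) + sumFin (λ i → f (suc i) + g (suc i))
    ≡⟨ cong ((f zero + g zero) +_) (sumFin-+ (f ∘ suc) (g ∘ suc)) ⟩
  (f zero + g zero) + (sumFin (f ∘ suc) + sumFin (g ∘ suc))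
    ≡⟨ +-interchange (f zero) (g zero) (sumFin (f ∘ suc)) (sumFin (g ∘ suc)) ⟩
  (f zero + sumFin (f ∘ suc)) + (g zero + sumFin (g ∘ suc)) ∎
  where open ≡-Reasoning

sumFin-*ˡ : ∀ {n} c (f : Fin n → ℚ) → sumFin (λ i → c * f i) ≡ c * sumFin f
sumFin-*ˡ {zero}  c f = sym (ℚ.*-zeroʳ c)
sumFin-*ˡ {suc n} c f =
  trans (cong (c * f zero +_) (sumFin-*ˡ c (f ∘ suc))) (sym (ℚ.*-distribˡ-+ c (f zero) _))

sumFin-mono-≤ : ∀ {n} {f g : Fin n → ℚ} → (∀ i → f i ≤ g i) → sumFin f ≤ sumFin g
sumFin-mono-≤ {zero}  f≤g = ℚ.≤-refl
sumFin-mono-≤ {suc n} f≤g = ℚ.+-mono-≤ (f≤g zero) (sumFin-mono-≤ (f≤g ∘ suc))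

sumFin-swap : ∀ {m n} (f : Fin m → Fin n → ℚ) →
  sumFin (λ i → sumFin (f i)) ≡ sumFin (λ j → sumFin (λ i → f i j))
sumFin-swap {zero}  {n} f = sym (sumFin-0 n)
sumFin-swap {suc m}     f = trans (cong (sumFin (f zero) +_) (sumFin-swap (f ∘ suc)))
  (sym (sumFin-+ (f zero) (λ j → sumFin (λ i → f (suc i) j))))

sumFin-const : ∀ n c → sumFin {n} (λ _ → c) ≡ ℕtoℚ n * c
sumFin-const zero    c = sym (ℚ.*-zeroˡ c)
sumFin-const (suc n) c = begin
  c + sumFin {n} (λ _ → c)   ≡⟨ cong (c +_) (sumFin-const n c) ⟩
  c + ℕtoℚ n * c             ≡⟨ sym (trans (ℚ.*-distribʳ-+ c 1ℚ (ℕtoℚ n)) (cong (_+ ℕtoℚ n * c) (ℚ.*-identityˡ c))) ⟩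
  (1ℚ + ℕtoℚ n) * c          ≡⟨ cong (_* c) (ℕtoℚ-+ 1 n) ⟨
  ℕtoℚ (suc n) * c           ∎
  where open ≡-Reasoning

sumFin-𝟙-≟ : ∀ {n} (v : Fin n) (g : Fin n → ℚ) → sumFin (λ i → 𝟙 (does (i Fin.≟ v)) * g i) ≡ g v
sumFin-𝟙-≟ {suc n} zero g = begin
  1ℚ * g zero + sumFin (λ i → 0ℚ * g (suc i))
    ≡⟨ cong₂ _+_ (ℚ.*-identityˡ (g zero)) (sumFin-cong (λ i → ℚ.*-zeroˡ (g (suc i)))) ⟩
  g zero + sumFin {n} (λ _ → 0ℚ)
    ≡⟨ trans (cong (g zero +_) (sumFin-0 n)) (ℚ.+-identityʳ (g zero)) ⟩
  g zero ∎
  where open ≡-Reasoning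
sumFin-𝟙-≟ {suc n} (suc v) g =
  trans (cong₂ _+_ (ℚ.*-zeroˡ (g zero)) (sumFin-𝟙-≟ v (g ∘ suc))) (ℚ.+-identityˡ (g (suc v)))

sumFin-𝟙-∈ : ∀ {n} (S : Subset n) → sumFin (λ j → 𝟙 (does (j ∈? S))) ≡ ℕtoℚ ∣ S ∣
sumFin-𝟙-∈ []            = refl
sumFin-𝟙-∈ (inside  ∷ S) = trans (cong (1ℚ +_) (sumFin-𝟙-∈ S)) (sym (ℕtoℚ-+ 1 ∣ S ∣))
sumFin-𝟙-∈ (outside ∷ S) = trans (cong (0ℚ +_) (sumFin-𝟙-∈ S)) (ℚ.+-identityˡ (ℕtoℚ ∣ S ∣))

-- Sums over all subsets

sumSubsets : ∀ n → (Subset n → ℚ) → ℚ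
sumSubsets zero    f = f []
sumSubsets (suc n) f = sumSubsets n (f ∘ (inside ∷_)) + sumSubsets n (f ∘ (outside ∷_))

sumSubsets-cong : ∀ n {f g : Subset n → ℚ} → (∀ S → f S ≡ g S) → sumSubsets n f ≡ sumSubsets n g
sumSubsets-cong zero    f≡g = f≡g []
sumSubsets-cong (suc n) f≡g =
  cong₂ _+_ (sumSubsets-cong n (f≡g ∘ (inside ∷_))) (sumSubsets-cong n (f≡g ∘ (outside ∷_)))

sumSubsets-0 : ∀ n → sumSubsets n (λ _ → 0ℚ) ≡ 0ℚ
sumSubsets-0 zero    = refl
sumSubsets-0 (suc n) = trans (cong₂ _+_ (sumSubsets-0 n) (sumSubsets-0 n)) (ℚ.+-identityˡ 0ℚ)

sumSubsets-+ : ∀ n (f g : Subset n → ℚ) →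
  sumSubsets n (λ S → f S + g S) ≡ sumSubsets n f + sumSubsets n g
sumSubsets-+ zero    f g = refl
sumSubsets-+ (suc n) f g = begin
  sumSubsets n (λ S → f (inside ∷ S) + g (inside ∷ S)) + sumSubsets n (λ S → f (outside ∷ S) + g (outside ∷ S))
    ≡⟨ cong₂ _+_ (sumSubsets-+ n (f ∘ (inside ∷_)) (g ∘ (inside ∷_)))
                 (sumSubsets-+ n (f ∘ (outside ∷_)) (g ∘ (outside ∷_))) ⟩
  (fᵢ + gᵢ) + (fₒ + gₒ)
    ≡⟨ +-interchange fᵢ gᵢ fₒ gₒ ⟩
  (fᵢ + fₒ) + (gᵢ + gₒ) ∎
  where
  open ≡-Reasoning
  fᵢ gᵢ fₒ gₒ : ℚ
  fᵢ = sumSubsets n (f ∘ (inside ∷_))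
  gᵢ = sumSubsets n (g ∘ (inside ∷_))
  fₒ = sumSubsets n (f ∘ (outside ∷_))
  gₒ = sumSubsets n (g ∘ (outside ∷_))

sumSubsets-*ˡ : ∀ n c (f : Subset n → ℚ) → sumSubsets n (λ S → c * f S) ≡ c * sumSubsets n f
sumSubsets-*ˡ zero    c f = refl
sumSubsets-*ˡ (suc n) c f = trans (cong₂ _+_ (sumSubsets-*ˡ n c _) (sumSubsets-*ˡ n c _))
  (sym (ℚ.*-distribˡ-+ c _ _))

sumSubsets-mono-≤ : ∀ n {f g : Subset n → ℚ} → (∀ S → f S ≤ g S) → sumSubsets n f ≤ sumSubsets n g
sumSubsets-mono-≤ zero    f≤g = f≤g []
sumSubsets-mono-≤ (suc n) f≤g =
  ℚ.+-mono-≤ (sumSubsets-mono-≤ n (f≤g ∘ (inside ∷_))) (sumSubsets-mono-≤ n (f≤g ∘ (outside ∷_)))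

sumSubsets-sumFin : ∀ n {m} (f : Subset n → Fin m → ℚ) →
  sumSubsets n (λ S → sumFin (f S)) ≡ sumFin (λ i → sumSubsets n (λ S → f S i))
sumSubsets-sumFin zero    f = refl
sumSubsets-sumFin (suc n) f = trans
  (cong₂ _+_ (sumSubsets-sumFin n (f ∘ (inside ∷_))) (sumSubsets-sumFin n (f ∘ (outside ∷_))))
  (sym (sumFin-+ (λ i → sumSubsets n (λ S → f (inside ∷ S) i)) (λ i → sumSubsets n (λ S → f (outside ∷ S) i))))

length-filter-map : ∀ {A B : Set} {P : B → Set} (P? : Decidable P) (f : A → B) (xs : List A) →
  length (filter P? (map f xs)) ≡ length (filter (P? ∘ f) xs)
length-filter-map P? f []       = refl
length-filter-map P? f (x ∷ xs) with does (P? (f x))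
... | true  = cong suc (length-filter-map P? f xs)
... | false = length-filter-map P? f xs

length-filter-allSubsets : ∀ n {P : Subset n → Set} (P? : Decidable P) →
  ℕtoℚ (length (filter P? (allSubsets n))) ≡ sumSubsets n (𝟙 ∘ does ∘ P?)
length-filter-allSubsets zero P? with does (P? [])
... | true  = refl
... | false = refl
length-filter-allSubsets (suc n) P? = begin
  ℕtoℚ (length (filter P? (map (inside ∷_) A ++ map (outside ∷_) A)))
    ≡⟨ cong (ℕtoℚ ∘ length) (List.filter-++ P? (map (inside ∷_) A) _) ⟩
  ℕtoℚ (length (filter P? (map (inside ∷_) A) ++ filter P? (map (outside ∷_) A)))
    ≡⟨ cong ℕtoℚ (List.length-++ (filter P? (map (inside ∷_) A))) ⟩
  ℕtoℚ (length (filter P? (map (inside ∷_) A)) ℕ.+ length (filter P? (map (outside ∷_) A)))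
    ≡⟨ ℕtoℚ-+ (length (filter P? (map (inside ∷_) A))) (length (filter P? (map (outside ∷_) A))) ⟩
  ℕtoℚ (length (filter P? (map (inside ∷_) A))) + ℕtoℚ (length (filter P? (map (outside ∷_) A)))
    ≡⟨ cong₂ (λ a b → ℕtoℚ a + ℕtoℚ b) (length-filter-map P? (inside ∷_) A) (length-filter-map P? (outside ∷_) A) ⟩
  ℕtoℚ (length (filter (P? ∘ (inside ∷_)) A)) + ℕtoℚ (length (filter (P? ∘ (outside ∷_)) A))
    ≡⟨ cong₂ _+_ (length-filter-allSubsets n (P? ∘ (inside ∷_))) (length-filter-allSubsets n (P? ∘ (outside ∷_))) ⟩
  sumSubsets (suc n) (𝟙 ∘ does ∘ P?) ∎
  where
  open ≡-Reasoning
  A : List (Subset n)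
  A = allSubsets n

sumSubsets-𝟙-nonNeg : ∀ n (b : Subset n → Bool) → 0ℚ ≤ sumSubsets n (𝟙 ∘ b)
sumSubsets-𝟙-nonNeg n b = subst (_≤ sumSubsets n (𝟙 ∘ b)) (sumSubsets-0 n) (sumSubsets-mono-≤ n (𝟙-nonNeg ∘ b))

-- Binomial coefficients

[k+1]*[n+1]C[k+1]≡[n+1]*nCk : ∀ n k → suc k ℕ.* (suc n C suc k) ≡ suc n ℕ.* (n C k)
[k+1]*[n+1]C[k+1]≡[n+1]*nCk zero    zero    = refl
[k+1]*[n+1]C[k+1]≡[n+1]*nCk zero    (suc k) = ℕ.*-zeroʳ (suc (suc k))
[k+1]*[n+1]C[k+1]≡[n+1]*nCk (suc n) zero    = begin
  1 ℕ.* (suc (suc n) C 1)   ≡⟨ ℕ.*-identityˡ _ ⟩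
  suc (suc n) C 1           ≡⟨ nC1≡n (suc (suc n)) ⟩
  suc (suc n)               ≡⟨ ℕ.*-identityʳ (suc (suc n)) ⟨
  suc (suc n) ℕ.* 1         ∎
  where open ≡-Reasoning
[k+1]*[n+1]C[k+1]≡[n+1]*nCk (suc n) (suc k) = begin
  (2 ℕ.+ k) ℕ.* (suc (suc n) C suc (suc k))
    ≡⟨ cong ((2 ℕ.+ k) ℕ.*_) (nCk+nC[k+1]≡[n+1]C[k+1] (suc n) (suc k)) ⟨
  (2 ℕ.+ k) ℕ.* (A ℕ.+ B)
    ≡⟨ expand k A B ⟩
  A ℕ.+ (1 ℕ.+ k) ℕ.* A ℕ.+ (2 ℕ.+ k) ℕ.* B
    ≡⟨ cong₂ (λ x y → A ℕ.+ x ℕ.+ y)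
             ([k+1]*[n+1]C[k+1]≡[n+1]*nCk n k) ([k+1]*[n+1]C[k+1]≡[n+1]*nCk n (suc k)) ⟩
  A ℕ.+ (1 ℕ.+ n) ℕ.* (n C k) ℕ.+ (1 ℕ.+ n) ℕ.* (n C suc k)
    ≡⟨ collect n A (n C k) (n C suc k) ⟩
  A ℕ.+ (1 ℕ.+ n) ℕ.* (n C k ℕ.+ n C suc k)
    ≡⟨ cong (λ x → A ℕ.+ (1 ℕ.+ n) ℕ.* x) (nCk+nC[k+1]≡[n+1]C[k+1] n k) ⟩
  A ℕ.+ (1 ℕ.+ n) ℕ.* A
    ≡⟨ absorb n A ⟩
  (2 ℕ.+ n) ℕ.* A ∎
  where
  open ≡-Reasoning
  A B : ℕ
  A = suc n C suc k
  B = suc n C suc (suc k)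
  expand : ∀ k x y → (2 ℕ.+ k) ℕ.* (x ℕ.+ y) ≡ x ℕ.+ (1 ℕ.+ k) ℕ.* x ℕ.+ (2 ℕ.+ k) ℕ.* y
  expand = ℕ-Ring.solve-∀
  collect : ∀ n x a b → x ℕ.+ (1 ℕ.+ n) ℕ.* a ℕ.+ (1 ℕ.+ n) ℕ.* b ≡ x ℕ.+ (1 ℕ.+ n) ℕ.* (a ℕ.+ b)
  collect = ℕ-Ring.solve-∀
  absorb : ∀ n x → x ℕ.+ (1 ℕ.+ n) ℕ.* x ≡ (2 ℕ.+ n) ℕ.* x
  absorb = ℕ-Ring.solve-∀

nCk≤[n+1]C[k+1] : ∀ n k → n C k ℕ.≤ suc n C suc k
nCk≤[n+1]C[k+1] n k = subst (n C k ℕ.≤_) (nCk+nC[k+1]≡[n+1]C[k+1] n k) (ℕ.m≤m+n (n C k) (n C suc k))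

degreeCount-identity : ∀ m k c₁ c₂ c₃ κ →
  (1 ℕ.+ k) ℕ.* c₂ ≡ (1 ℕ.+ m) ℕ.* c₃ → (2 ℕ.+ k) ℕ.* c₁ ≡ (2 ℕ.+ m) ℕ.* c₂ → 2 ℕ.* κ ≡ (3 ℕ.+ k) ℕ.* (2 ℕ.+ k) →
  (3 ℕ.+ m) ℕ.* ((3 ℕ.+ m) ℕ.* c₃ ℕ.+ (c₂ ℕ.+ c₂))
    ≡ (κ ℕ.* c₁ ℕ.+ κ ℕ.* c₁) ℕ.+ (3 ℕ.+ k) ℕ.* c₂ ℕ.+ (3 ℕ.+ m) ℕ.* (c₃ ℕ.+ c₃)
degreeCount-identity m k c₁ c₂ c₃ κ e₁ e₂ e₃ = begin
  (3 ℕ.+ m) ℕ.* ((3 ℕ.+ m) ℕ.* c₃ ℕ.+ (c₂ ℕ.+ c₂))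
    ≡⟨ ℕ-Ring.solve (m List.∷ c₂ List.∷ c₃ List.∷ List.[]) ⟩
  (3 ℕ.+ m) ℕ.* ((1 ℕ.+ m) ℕ.* c₃ ℕ.+ (c₂ ℕ.+ c₂)) ℕ.+ (3 ℕ.+ m) ℕ.* (c₃ ℕ.+ c₃)
    ≡⟨ cong (λ x → (3 ℕ.+ m) ℕ.* (x ℕ.+ (c₂ ℕ.+ c₂)) ℕ.+ (3 ℕ.+ m) ℕ.* (c₃ ℕ.+ c₃)) e₁ ⟨
  (3 ℕ.+ m) ℕ.* ((1 ℕ.+ k) ℕ.* c₂ ℕ.+ (c₂ ℕ.+ c₂)) ℕ.+ (3 ℕ.+ m) ℕ.* (c₃ ℕ.+ c₃)
    ≡⟨ ℕ-Ring.solve (m List.∷ k List.∷ c₂ List.∷ c₃ List.∷ List.[]) ⟩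
  (3 ℕ.+ k) ℕ.* ((2 ℕ.+ m) ℕ.* c₂) ℕ.+ (3 ℕ.+ k) ℕ.* c₂ ℕ.+ (3 ℕ.+ m) ℕ.* (c₃ ℕ.+ c₃)
    ≡⟨ cong (λ x → (3 ℕ.+ k) ℕ.* x ℕ.+ (3 ℕ.+ k) ℕ.* c₂ ℕ.+ (3 ℕ.+ m) ℕ.* (c₃ ℕ.+ c₃)) e₂ ⟨
  (3 ℕ.+ k) ℕ.* ((2 ℕ.+ k) ℕ.* c₁) ℕ.+ (3 ℕ.+ k) ℕ.* c₂ ℕ.+ (3 ℕ.+ m) ℕ.* (c₃ ℕ.+ c₃)
    ≡⟨ ℕ-Ring.solve (k List.∷ m List.∷ c₁ List.∷ c₂ List.∷ c₃ List.∷ List.[]) ⟩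
  ((3 ℕ.+ k) ℕ.* (2 ℕ.+ k)) ℕ.* c₁ ℕ.+ (3 ℕ.+ k) ℕ.* c₂ ℕ.+ (3 ℕ.+ m) ℕ.* (c₃ ℕ.+ c₃)
    ≡⟨ cong (λ x → x ℕ.* c₁ ℕ.+ (3 ℕ.+ k) ℕ.* c₂ ℕ.+ (3 ℕ.+ m) ℕ.* (c₃ ℕ.+ c₃)) e₃ ⟨
  (2 ℕ.* κ) ℕ.* c₁ ℕ.+ (3 ℕ.+ k) ℕ.* c₂ ℕ.+ (3 ℕ.+ m) ℕ.* (c₃ ℕ.+ c₃)
    ≡⟨ ℕ-Ring.solve (κ List.∷ k List.∷ m List.∷ c₁ List.∷ c₂ List.∷ c₃ List.∷ List.[]) ⟩
  (κ ℕ.* c₁ ℕ.+ κ ℕ.* c₁) ℕ.+ (3 ℕ.+ k) ℕ.* c₂ ℕ.+ (3 ℕ.+ m) ℕ.* (c₃ ℕ.+ c₃) ∎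
  where open ≡-Reasoning

-- Supersets

x∉p⇒∣⁅x⁆∪p∣≡1+∣p∣ : ∀ {n} {x : Fin n} (p : Subset n) → x ∉ p → ∣ ⁅ x ⁆ ∪ p ∣ ≡ suc ∣ p ∣
x∉p⇒∣⁅x⁆∪p∣≡1+∣p∣ {x = zero}  (inside  ∷ p) x∉p = ⊥-elim (x∉p here)
x∉p⇒∣⁅x⁆∪p∣≡1+∣p∣ {x = zero}  (outside ∷ p) _   = cong (suc ∘ ∣_∣) (∪-identityˡ p)
x∉p⇒∣⁅x⁆∪p∣≡1+∣p∣ {x = suc x} (inside  ∷ p) x∉p = cong suc (x∉p⇒∣⁅x⁆∪p∣≡1+∣p∣ p (x∉p ∘ there))
x∉p⇒∣⁅x⁆∪p∣≡1+∣p∣ {x = suc x} (outside ∷ p) x∉p = x∉p⇒∣⁅x⁆∪p∣≡1+∣p∣ p (x∉p ∘ there)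

x∈p⇒∣⁅x⁆∪p∣≡∣p∣ : ∀ {n} {x : Fin n} {p : Subset n} → x ∈ p → ∣ ⁅ x ⁆ ∪ p ∣ ≡ ∣ p ∣
x∈p⇒∣⁅x⁆∪p∣≡∣p∣ {p = inside  ∷ p} here        = cong (suc ∘ ∣_∣) (∪-identityˡ p)
x∈p⇒∣⁅x⁆∪p∣≡∣p∣ {p = inside  ∷ p} (there x∈p) = cong suc (x∈p⇒∣⁅x⁆∪p∣≡∣p∣ x∈p)
x∈p⇒∣⁅x⁆∪p∣≡∣p∣ {p = outside ∷ p} (there x∈p) = x∈p⇒∣⁅x⁆∪p∣≡∣p∣ x∈p

∣⁅i⁆∪⁅j⁆∣≡2 : ∀ {n} {i j : Fin n} → i ≢ j → ∣ ⁅ i ⁆ ∪ ⁅ j ⁆ ∣ ≡ 2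
∣⁅i⁆∪⁅j⁆∣≡2 {j = j} i≢j = trans (x∉p⇒∣⁅x⁆∪p∣≡1+∣p∣ ⁅ j ⁆ (x≢y⇒x∉⁅y⁆ i≢j)) (cong suc (∣⁅x⁆∣≡1 j))

does-⁅x⁆⊆? : ∀ {n} (x : Fin n) S → does (⁅ x ⁆ ⊆? S) ≡ does (x ∈? S)
does-⁅x⁆⊆? x S = does-⇔ (mk⇔ (λ ⁅x⁆⊆S → ⁅x⁆⊆S (x∈⁅x⁆ x))
                              (λ x∈S {y} y∈⁅x⁆ → subst (_∈ S) (sym (x∈⁅y⁆⇒x≡y x y∈⁅x⁆)) x∈S))
                        (⁅ x ⁆ ⊆? S) (x ∈? S)

does-∪⊆? : ∀ {n} (p q S : Subset n) → does (p ∪ q ⊆? S) ≡ does (p ⊆? S) ∧ does (q ⊆? S)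
does-∪⊆? p q S = does-⇔ (mk⇔ split join) (p ∪ q ⊆? S) (p ⊆? S ×-dec q ⊆? S)
  where
  split : p ∪ q ⊆ S → p ⊆ S × q ⊆ S
  split p∪q⊆S = p∪q⊆S ∘ p⊆p∪q q , p∪q⊆S ∘ q⊆p∪q p q
  join : p ⊆ S × q ⊆ S → p ∪ q ⊆ S
  join (p⊆S , q⊆S) = either p⊆S q⊆S ∘ x∈p∪q⁻ p q

does-⁅x,y,z⁆⊆? : ∀ {n} (x y z : Fin n) S →
  does (⁅ x ⁆ ∪ (⁅ y ⁆ ∪ ⁅ z ⁆) ⊆? S) ≡ does (x ∈? S) ∧ (does (y ∈? S) ∧ does (z ∈? S))
does-⁅x,y,z⁆⊆? x y z S = begin
  does (⁅ x ⁆ ∪ (⁅ y ⁆ ∪ ⁅ z ⁆) ⊆? S)                  ≡⟨ does-∪⊆? ⁅ x ⁆ (⁅ y ⁆ ∪ ⁅ z ⁆) S ⟩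
  does (⁅ x ⁆ ⊆? S) ∧ does (⁅ y ⁆ ∪ ⁅ z ⁆ ⊆? S)        ≡⟨ cong₂ _∧_ (does-⁅x⁆⊆? x S) (does-∪⊆? ⁅ y ⁆ ⁅ z ⁆ S) ⟩
  does (x ∈? S) ∧ (does (⁅ y ⁆ ⊆? S) ∧ does (⁅ z ⁆ ⊆? S)) ≡⟨ cong (does (x ∈? S) ∧_) (cong₂ _∧_ (does-⁅x⁆⊆? y S) (does-⁅x⁆⊆? z S)) ⟩
  does (x ∈? S) ∧ (does (y ∈? S) ∧ does (z ∈? S))      ∎
  where open ≡-Reasoning

#supersets : ∀ n → Subset n → ℕ → ℚ
#supersets n A r = sumSubsets n (λ S → 𝟙 (does (∣ S ∣ ℕ.≟ r) ∧ does (A ⊆? S)))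

sumSubsets-𝟙-∧-false : ∀ n (b : Subset n → Bool) → sumSubsets n (λ S → 𝟙 (b S ∧ false)) ≡ 0ℚ
sumSubsets-𝟙-∧-false n b = trans (sumSubsets-cong n (cong 𝟙 ∘ 𝔹.∧-zeroʳ ∘ b)) (sumSubsets-0 n)

#supersets-< : ∀ n A r → r ℕ.< ∣ A ∣ → #supersets n A r ≡ 0ℚ
#supersets-< (suc n) (inside ∷ A) zero _ = trans
  (cong₂ _+_ (sumSubsets-0 n) (sumSubsets-𝟙-∧-false n (λ S → does (∣ S ∣ ℕ.≟ 0)))) (ℚ.+-identityˡ 0ℚ)
#supersets-< (suc n) (inside ∷ A) (suc r) (s≤s r<∣A∣) = trans
  (cong₂ _+_ (#supersets-< n A r r<∣A∣) (sumSubsets-𝟙-∧-false n (λ S → does (∣ S ∣ ℕ.≟ suc r)))) (ℚ.+-identityˡ 0ℚ)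
#supersets-< (suc n) (outside ∷ A) zero 0<∣A∣ = trans
  (cong₂ _+_ (sumSubsets-0 n) (#supersets-< n A zero 0<∣A∣)) (ℚ.+-identityˡ 0ℚ)
#supersets-< (suc n) (outside ∷ A) (suc r) r<∣A∣ = trans
  (cong₂ _+_ (#supersets-< n A r (ℕ.<-trans (ℕ.n<1+n r) r<∣A∣)) (#supersets-< n A (suc r) r<∣A∣)) (ℚ.+-identityˡ 0ℚ)

#supersets-∣A∣+k : ∀ n A k → #supersets n A (∣ A ∣ ℕ.+ k) ≡ ℕtoℚ ((n ∸ ∣ A ∣) C k)
#supersets-∣A∣+k zero    []            zero    = refl
#supersets-∣A∣+k zero    []            (suc k) = refl
#supersets-∣A∣+k (suc n) (inside ∷ A)  k       = trans
  (cong₂ _+_ (#supersets-∣A∣+k n A k) (sumSubsets-𝟙-∧-false n (λ S → does (∣ S ∣ ℕ.≟ suc (∣ A ∣ ℕ.+ k)))))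
  (ℚ.+-identityʳ _)
#supersets-∣A∣+k (suc n) (outside ∷ A) zero    = trans
  (cong₂ _+_ (smaller (∣ A ∣ ℕ.+ 0) (ℕ.≤-reflexive (ℕ.+-identityʳ ∣ A ∣))) (#supersets-∣A∣+k n A 0))
  (ℚ.+-identityˡ _)
  where
  smaller : ∀ r → r ℕ.≤ ∣ A ∣ → sumSubsets n (λ S → 𝟙 (does (suc ∣ S ∣ ℕ.≟ r) ∧ does (A ⊆? S))) ≡ 0ℚ
  smaller zero    _     = sumSubsets-0 n
  smaller (suc r) r<∣A∣ = #supersets-< n A r r<∣A∣
#supersets-∣A∣+k (suc n) (outside ∷ A) (suc k) = begin
  sumSubsets n (λ S → 𝟙 (does (suc ∣ S ∣ ℕ.≟ ∣ A ∣ ℕ.+ suc k) ∧ does (A ⊆? S))) + #supersets n A (∣ A ∣ ℕ.+ suc k)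
    ≡⟨ cong (λ r → sumSubsets n (λ S → 𝟙 (does (suc ∣ S ∣ ℕ.≟ r) ∧ does (A ⊆? S))) + #supersets n A (∣ A ∣ ℕ.+ suc k))
            (ℕ.+-suc ∣ A ∣ k) ⟩
  #supersets n A (∣ A ∣ ℕ.+ k) + #supersets n A (∣ A ∣ ℕ.+ suc k)
    ≡⟨ cong₂ _+_ (#supersets-∣A∣+k n A k) (#supersets-∣A∣+k n A (suc k)) ⟩
  ℕtoℚ ((n ∸ ∣ A ∣) C k) + ℕtoℚ ((n ∸ ∣ A ∣) C suc k)
    ≡⟨ ℕtoℚ-+ ((n ∸ ∣ A ∣) C k) ((n ∸ ∣ A ∣) C suc k) ⟨
  ℕtoℚ ((n ∸ ∣ A ∣) C k ℕ.+ (n ∸ ∣ A ∣) C suc k)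
    ≡⟨ cong ℕtoℚ (nCk+nC[k+1]≡[n+1]C[k+1] (n ∸ ∣ A ∣) k) ⟩
  ℕtoℚ (suc (n ∸ ∣ A ∣) C suc k)
    ≡⟨ cong (λ m → ℕtoℚ (m C suc k)) (ℕ.+-∸-assoc 1 (∣p∣≤n A)) ⟨
  ℕtoℚ ((suc n ∸ ∣ A ∣) C suc k) ∎
  where open ≡-Reasoning

#supersets-of-size : ∀ n A a k → ∣ A ∣ ≡ a → #supersets n A (a ℕ.+ k) ≡ ℕtoℚ ((n ∸ a) C k)
#supersets-of-size n A _ k refl = #supersets-∣A∣+k n A k

-- Clique weights

orderedPairIn : ∀ {n} → Subset n → Fin n → Fin n → Bool
orderedPairIn S i j = does (i Fin.<? j) ∧ does (i ∈? S) ∧ does (j ∈? S)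

edgeWeightIn : ∀ {n} → (Fin n → Fin n → ℚ) → Subset n → Fin n → Fin n → ℚ
edgeWeightIn w S i j = if orderedPairIn S i j then w i j else 0ℚ

sumFin²-𝟙-orderedPairIn : ∀ {n} (S : Subset n) →
  sumFin (λ i → sumFin (λ j → 𝟙 (orderedPairIn S i j))) ≡ ℕtoℚ (∣ S ∣ C 2)
sumFin²-𝟙-orderedPairIn [] = refl
sumFin²-𝟙-orderedPairIn {suc n} (s ∷ S) = begin
  (0ℚ + firstRow s) + sumFin (λ i → 0ℚ + sumFin (λ j → 𝟙 (orderedPairIn S i j)))
    ≡⟨ cong₂ _+_ (ℚ.+-identityˡ (firstRow s)) (sumFin-cong (λ i → ℚ.+-identityˡ (sumFin (λ j → 𝟙 (orderedPairIn S i j))))) ⟩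
  firstRow s + sumFin (λ i → sumFin (λ j → 𝟙 (orderedPairIn S i j)))
    ≡⟨ cong (firstRow s +_) (sumFin²-𝟙-orderedPairIn S) ⟩
  firstRow s + ℕtoℚ (∣ S ∣ C 2)
    ≡⟨ step s ⟩
  ℕtoℚ (∣ s ∷ S ∣ C 2) ∎
  where
  open ≡-Reasoning
  firstRow : Bool → ℚ
  firstRow s = sumFin (λ j → 𝟙 (orderedPairIn (s ∷ S) zero (suc j)))
  step : ∀ s → firstRow s + ℕtoℚ (∣ S ∣ C 2) ≡ ℕtoℚ (∣ s ∷ S ∣ C 2)
  step inside = begin
    firstRow inside + ℕtoℚ (∣ S ∣ C 2)           ≡⟨ cong (_+ ℕtoℚ (∣ S ∣ C 2)) (sumFin-𝟙-∈ S) ⟩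
    ℕtoℚ ∣ S ∣ + ℕtoℚ (∣ S ∣ C 2)                ≡⟨ cong (λ m → ℕtoℚ m + ℕtoℚ (∣ S ∣ C 2)) (nC1≡n ∣ S ∣) ⟨
    ℕtoℚ (∣ S ∣ C 1) + ℕtoℚ (∣ S ∣ C 2)          ≡⟨ ℕtoℚ-+ (∣ S ∣ C 1) (∣ S ∣ C 2) ⟨
    ℕtoℚ (∣ S ∣ C 1 ℕ.+ ∣ S ∣ C 2)               ≡⟨ cong ℕtoℚ (nCk+nC[k+1]≡[n+1]C[k+1] ∣ S ∣ 1) ⟩
    ℕtoℚ (suc ∣ S ∣ C 2)                         ∎
  step outside = trans (cong (_+ ℕtoℚ (∣ S ∣ C 2)) (sumFin-0 n)) (ℚ.+-identityˡ _)

cliqueWeight-≤ : ∀ {n} {w : Fin n → Fin n → ℚ} → InUnitInterval w →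
  ∀ S → cliqueWeight w S ≤ ℕtoℚ (∣ S ∣ C 2)
cliqueWeight-≤ {w = w} w-unit S = subst (cliqueWeight w S ≤_) (sumFin²-𝟙-orderedPairIn S)
  (sumFin-mono-≤ (λ i → sumFin-mono-≤ (λ j → edgeWeight≤𝟙 (i Fin.<? j) (does (i ∈? S) ∧ does (j ∈? S)))))
  where
  edgeWeight≤𝟙 : ∀ {i j} (i<?j : Dec (i Fin.< j)) c →
    (if does i<?j ∧ c then w i j else 0ℚ) ≤ 𝟙 (does i<?j ∧ c)
  edgeWeight≤𝟙 (no  _)   _     = ℚ.≤-refl
  edgeWeight≤𝟙 (yes _)   false = ℚ.≤-refl
  edgeWeight≤𝟙 (yes i<j) true  = proj₂ (w-unit _ _ (Fin.<⇒≢ i<j))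

-- The diagonal values of w are junk; offDiag discards them exactly as wdeg does, so that
-- wdeg w v is definitionally sumFin (offDiag w v).
offDiag : ∀ {n} → (Fin n → Fin n → ℚ) → Fin n → Fin n → ℚ
offDiag w i j = if does (j Fin.≟ i) then 0ℚ else w i j

offDiag-*-cong : ∀ {n} (w : Fin n → Fin n → ℚ) i j {x y} → (i ≢ j → x ≡ y) → offDiag w i j * x ≡ offDiag w i j * y
offDiag-*-cong w i j {x} {y} = onDiagonal? (j Fin.≟ i)
  where
  onDiagonal? : (j≟i : Dec (j ≡ i)) → (i ≢ j → x ≡ y) →
    (if does j≟i then 0ℚ else w i j) * x ≡ (if does j≟i then 0ℚ else w i j) * y
  onDiagonal? (yes _)   _     = trans (ℚ.*-zeroˡ x) (sym (ℚ.*-zeroˡ y))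
  onDiagonal? (no j≢i)  x≡y   = cong (w i j *_) (x≡y (j≢i ∘ sym))

module _ {n} {w : Fin n → Fin n → ℚ} (w-sym : Symmetric w) where

  offDiag-sym : ∀ i j → offDiag w i j ≡ offDiag w j i
  offDiag-sym i j = trans
    (cong (λ b → if b then 0ℚ else w i j) (does-⇔ (mk⇔ sym sym) (j Fin.≟ i) (i Fin.≟ j)))
    (cong (λ x → if does (i Fin.≟ j) then 0ℚ else x) (w-sym i j))

  offDiag-both-orders : ∀ S i j →
    𝟙 (does (i ∈? S) ∧ does (j ∈? S)) * offDiag w i j ≡ edgeWeightIn w S i j + edgeWeightIn w S j i
  offDiag-both-orders S i j with Fin.<-cmp i j
  ... | tri< i<j _ _
    rewrite dec-true (i Fin.<? j) i<j | dec-false (j Fin.<? i) (Fin.<-asym i<j)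
          | dec-false (j Fin.≟ i) (≢-sym (Fin.<⇒≢ i<j))
    = trans (𝟙*≡if (does (i ∈? S) ∧ does (j ∈? S)) (w i j)) (sym (ℚ.+-identityʳ _))
  ... | tri> _ _ j<i
    rewrite dec-true (j Fin.<? i) j<i | dec-false (i Fin.<? j) (Fin.<-asym j<i)
          | dec-false (j Fin.≟ i) (Fin.<⇒≢ j<i)
    = trans (cong₂ (λ b x → 𝟙 b * x) (𝔹.∧-comm (does (i ∈? S)) (does (j ∈? S))) (w-sym i j))
            (trans (𝟙*≡if (does (j ∈? S) ∧ does (i ∈? S)) (w j i)) (sym (ℚ.+-identityˡ _)))
  ... | tri≈ _ refl _
    rewrite dec-true (i Fin.≟ i) refl | dec-false (i Fin.<? i) (Fin.<-irrefl refl)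
    = trans (ℚ.*-zeroʳ (𝟙 (does (i ∈? S) ∧ does (i ∈? S)))) (sym (ℚ.+-identityʳ 0ℚ))

  cliqueWeight-double : ∀ S →
    cliqueWeight w S + cliqueWeight w S ≡ sumFin (λ i → sumFin (λ j → 𝟙 (does (i ∈? S) ∧ does (j ∈? S)) * offDiag w i j))
  cliqueWeight-double S = sym (begin
    sumFin (λ i → sumFin (λ j → 𝟙 (does (i ∈? S) ∧ does (j ∈? S)) * offDiag w i j))
      ≡⟨ sumFin-cong (λ i → sumFin-cong (offDiag-both-orders S i)) ⟩
    sumFin (λ i → sumFin (λ j → e i j + e j i))
      ≡⟨ sumFin-cong (λ i → sumFin-+ (e i) (λ j → e j i)) ⟩
    sumFin (λ i → sumFin (e i) + sumFin (λ j → e j i))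
      ≡⟨ sumFin-+ (λ i → sumFin (e i)) (λ i → sumFin (λ j → e j i)) ⟩
    cliqueWeight w S + sumFin (λ i → sumFin (λ j → e j i))
      ≡⟨ cong (cliqueWeight w S +_) (sumFin-swap (λ i j → e j i)) ⟩
    cliqueWeight w S + cliqueWeight w S ∎)
    where
    open ≡-Reasoning
    e : Fin n → Fin n → ℚ
    e = edgeWeightIn w S

  sumFin²-offDiag-at : ∀ v c d →
    sumFin (λ i → sumFin (λ j → offDiag w i j * (c + d * (𝟙 (does (i Fin.≟ v)) + 𝟙 (does (j Fin.≟ v))))))
      ≡ c * sumFin (wdeg w) + d * (wdeg w v + wdeg w v)
  sumFin²-offDiag-at v c d = begin
    sumFin (λ i → sumFin (λ j → offDiag w i j * (c + d * (X i + X j))))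
      ≡⟨ sumFin-cong (λ i → sumFin-cong (λ j → distrib (offDiag w i j) c d (X i) (X j))) ⟩
    sumFin (λ i → sumFin (λ j → c * offDiag w i j + d * (X i * offDiag w i j + X j * offDiag w i j)))
      ≡⟨ sumFin-cong (λ i → sumFin-linear c d (offDiag w i) _ _) ⟩
    sumFin (λ i → c * wdeg w i + d * (sumFin (λ j → X i * offDiag w i j) + sumFin (λ j → X j * offDiag w i j)))
      ≡⟨ sumFin-linear c d (wdeg w) _ _ ⟩
    c * sumFin (wdeg w) + d * (sumFin (λ i → sumFin (λ j → X i * offDiag w i j))
                             + sumFin (λ i → sumFin (λ j → X j * offDiag w i j)))
      ≡⟨ cong (λ x → c * sumFin (wdeg w) + d * x) (cong₂ _+_ rows columns) ⟩
    c * sumFin (wdeg w) + d * (wdeg w v + wdeg w v) ∎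
    where
    open ≡-Reasoning
    X : Fin n → ℚ
    X i = 𝟙 (does (i Fin.≟ v))
    distrib : ∀ a c d x y → a * (c + d * (x + y)) ≡ c * a + d * (x * a + y * a)
    distrib = solve-∀ ℚ-ring
    sumFin-linear : ∀ {m} c d (f g h : Fin m → ℚ) →
      sumFin (λ i → c * f i + d * (g i + h i)) ≡ c * sumFin f + d * (sumFin g + sumFin h)
    sumFin-linear c d f g h = trans (sumFin-+ (λ i → c * f i) (λ i → d * (g i + h i)))
      (cong₂ _+_ (sumFin-*ˡ c f) (trans (sumFin-*ˡ d (λ i → g i + h i)) (cong (d *_) (sumFin-+ g h))))
    rows : sumFin (λ i → sumFin (λ j → X i * offDiag w i j)) ≡ wdeg w v
    rows = trans (sumFin-cong (λ i → sumFin-*ˡ (X i) (offDiag w i))) (sumFin-𝟙-≟ v (wdeg w))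
    columns : sumFin (λ i → sumFin (λ j → X j * offDiag w i j)) ≡ wdeg w v
    columns = begin
      sumFin (λ i → sumFin (λ j → X j * offDiag w i j))  ≡⟨ sumFin-swap (λ i j → X j * offDiag w i j) ⟩
      sumFin (λ j → sumFin (λ i → X j * offDiag w i j))  ≡⟨ sumFin-cong (λ j → sumFin-*ˡ (X j) (λ i → offDiag w i j)) ⟩
      sumFin (λ j → X j * sumFin (λ i → offDiag w i j))  ≡⟨ sumFin-𝟙-≟ v (λ j → sumFin (λ i → offDiag w i j)) ⟩
      sumFin (λ i → offDiag w i v)                       ≡⟨ sumFin-cong (λ i → offDiag-sym i v) ⟩
      wdeg w v                                           ∎

-- Cliques through a fixed vertex

module _ {n} (r : ℕ) (v : Fin n) where

  isCliqueAt : Subset n → Bool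
  isCliqueAt S = does (∣ S ∣ ℕ.≟ r) ∧ does (v ∈? S)

  cliqueWeightSum : (Fin n → Fin n → ℚ) → ℚ
  cliqueWeightSum w = sumSubsets n (λ S → 𝟙 (isCliqueAt S) * cliqueWeight w S)

sumSubsets-𝟙-isCliqueAt : ∀ {n} k (v : Fin n) →
  sumSubsets n (𝟙 ∘ isCliqueAt (suc k) v) ≡ ℕtoℚ ((n ∸ 1) C k)
sumSubsets-𝟙-isCliqueAt {n} k v = trans
  (sumSubsets-cong n (λ S → cong (λ b → 𝟙 (does (∣ S ∣ ℕ.≟ suc k) ∧ b)) (sym (does-⁅x⁆⊆? v S))))
  (#supersets-of-size n ⁅ v ⁆ 1 k (∣⁅x⁆∣≡1 v))

cliqueWeightSum-double : ∀ {n} r (v : Fin n) {w} → Symmetric w →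
  cliqueWeightSum r v w + cliqueWeightSum r v w
    ≡ sumFin (λ i → sumFin (λ j → offDiag w i j * #supersets n (⁅ v ⁆ ∪ (⁅ i ⁆ ∪ ⁅ j ⁆)) r))
cliqueWeightSum-double {n} r v {w} w-sym = begin
  cliqueWeightSum r v w + cliqueWeightSum r v w
    ≡⟨ sumSubsets-+ n (λ S → 𝟙 (E S) * cliqueWeight w S) _ ⟨
  sumSubsets n (λ S → 𝟙 (E S) * cliqueWeight w S + 𝟙 (E S) * cliqueWeight w S)
    ≡⟨ sumSubsets-cong n (λ S → trans (sym (ℚ.*-distribˡ-+ (𝟙 (E S)) _ _)) (cong (𝟙 (E S) *_) (cliqueWeight-double w-sym S))) ⟩
  sumSubsets n (λ S → 𝟙 (E S) * sumFin (λ i → sumFin (λ j → 𝟙 (P S i j) * offDiag w i j)))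
    ≡⟨ sumSubsets-cong n (λ S → trans (sym (sumFin-*ˡ (𝟙 (E S)) (λ i → sumFin (λ j → 𝟙 (P S i j) * offDiag w i j))))
                                 (sumFin-cong (λ i → trans (sym (sumFin-*ˡ (𝟙 (E S)) (λ j → 𝟙 (P S i j) * offDiag w i j)))
                                   (sumFin-cong (λ j → regroup S i j))))) ⟩
  sumSubsets n (λ S → sumFin (λ i → sumFin (λ j → offDiag w i j * 𝟙 (E S ∧ P S i j))))
    ≡⟨ sumSubsets-sumFin n (λ S i → sumFin (λ j → offDiag w i j * 𝟙 (E S ∧ P S i j))) ⟩
  sumFin (λ i → sumSubsets n (λ S → sumFin (λ j → offDiag w i j * 𝟙 (E S ∧ P S i j))))
    ≡⟨ sumFin-cong (λ i → sumSubsets-sumFin n (λ S j → offDiag w i j * 𝟙 (E S ∧ P S i j))) ⟩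
  sumFin (λ i → sumFin (λ j → sumSubsets n (λ S → offDiag w i j * 𝟙 (E S ∧ P S i j))))
    ≡⟨ sumFin-cong (λ i → sumFin-cong (λ j → trans (sumSubsets-*ˡ n (offDiag w i j) _)
                                         (cong (offDiag w i j *_) (sumSubsets-cong n (λ S → cong 𝟙 (containsTriple S i j)))))) ⟩
  sumFin (λ i → sumFin (λ j → offDiag w i j * #supersets n (⁅ v ⁆ ∪ (⁅ i ⁆ ∪ ⁅ j ⁆)) r)) ∎
  where
  open ≡-Reasoning
  E : Subset n → Bool
  E = isCliqueAt r v
  P : Subset n → Fin n → Fin n → Bool
  P S i j = does (i ∈? S) ∧ does (j ∈? S)
  regroup : ∀ S i j → 𝟙 (E S) * (𝟙 (P S i j) * offDiag w i j) ≡ offDiag w i j * 𝟙 (E S ∧ P S i j)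
  regroup S i j = trans (sym (ℚ.*-assoc (𝟙 (E S)) _ _))
    (trans (ℚ.*-comm _ (offDiag w i j)) (cong (offDiag w i j *_) (sym (𝟙-∧ (E S) (P S i j)))))
  containsTriple : ∀ S i j → E S ∧ P S i j ≡ does (∣ S ∣ ℕ.≟ r) ∧ does (⁅ v ⁆ ∪ (⁅ i ⁆ ∪ ⁅ j ⁆) ⊆? S)
  containsTriple S i j = begin
    (does (∣ S ∣ ℕ.≟ r) ∧ does (v ∈? S)) ∧ P S i j
      ≡⟨ 𝔹.∧-assoc (does (∣ S ∣ ℕ.≟ r)) (does (v ∈? S)) (P S i j) ⟩
    does (∣ S ∣ ℕ.≟ r) ∧ (does (v ∈? S) ∧ P S i j)
      ≡⟨ cong (does (∣ S ∣ ℕ.≟ r) ∧_) (does-⁅x,y,z⁆⊆? v i j S) ⟨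
    does (∣ S ∣ ℕ.≟ r) ∧ does (⁅ v ⁆ ∪ (⁅ i ⁆ ∪ ⁅ j ⁆) ⊆? S) ∎

-- An r-set through v containing the edge ij is a superset of {v, i, j}, which has two
-- elements if v is an endpoint of ij and three otherwise.
#supersets-triple : ∀ m k (v i j : Fin (3 ℕ.+ m)) → i ≢ j →
  #supersets (3 ℕ.+ m) (⁅ v ⁆ ∪ (⁅ i ⁆ ∪ ⁅ j ⁆)) (3 ℕ.+ k)
    ≡ ℕtoℚ (m C k) + (ℕtoℚ ((1 ℕ.+ m) C (1 ℕ.+ k)) - ℕtoℚ (m C k)) * (𝟙 (does (i Fin.≟ v)) + 𝟙 (does (j Fin.≟ v)))
#supersets-triple m k v i j i≢j with i Fin.≟ v | j Fin.≟ v
... | yes refl | yes refl = ⊥-elim (i≢j refl)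
... | yes refl | no _ = trans
  (#supersets-of-size (3 ℕ.+ m) (⁅ v ⁆ ∪ (⁅ i ⁆ ∪ ⁅ j ⁆)) 2 (1 ℕ.+ k) (trans (x∈p⇒∣⁅x⁆∪p∣≡∣p∣ (x∈p∪q⁺ (inj₁ (x∈⁅x⁆ v)))) (∣⁅i⁆∪⁅j⁆∣≡2 i≢j)))
  (pair-value (ℕtoℚ ((1 ℕ.+ m) C (1 ℕ.+ k))) (ℕtoℚ (m C k)))
  where
  pair-value : ∀ x y → x ≡ y + (x - y) * (1ℚ + 0ℚ)
  pair-value = solve-∀ ℚ-ring
... | no _ | yes refl = trans
  (#supersets-of-size (3 ℕ.+ m) (⁅ v ⁆ ∪ (⁅ i ⁆ ∪ ⁅ j ⁆)) 2 (1 ℕ.+ k) (trans (x∈p⇒∣⁅x⁆∪p∣≡∣p∣ (x∈p∪q⁺ (inj₂ (x∈⁅x⁆ v)))) (∣⁅i⁆∪⁅j⁆∣≡2 i≢j)))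
  (pair-value (ℕtoℚ ((1 ℕ.+ m) C (1 ℕ.+ k))) (ℕtoℚ (m C k)))
  where
  pair-value : ∀ x y → x ≡ y + (x - y) * (0ℚ + 1ℚ)
  pair-value = solve-∀ ℚ-ring
... | no i≢v | no j≢v = trans
  (#supersets-of-size (3 ℕ.+ m) (⁅ v ⁆ ∪ (⁅ i ⁆ ∪ ⁅ j ⁆)) 3 k (trans (x∉p⇒∣⁅x⁆∪p∣≡1+∣p∣ (⁅ i ⁆ ∪ ⁅ j ⁆) v∉) (cong suc (∣⁅i⁆∪⁅j⁆∣≡2 i≢j))))
  (triple-value (ℕtoℚ ((1 ℕ.+ m) C (1 ℕ.+ k))) (ℕtoℚ (m C k)))
  where
  v∉ : v ∉ ⁅ i ⁆ ∪ ⁅ j ⁆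
  v∉ = either (i≢v ∘ sym ∘ x∈⁅y⁆⇒x≡y i) (j≢v ∘ sym ∘ x∈⁅y⁆⇒x≡y j) ∘ x∈p∪q⁻ ⁅ i ⁆ ⁅ j ⁆
  triple-value : ∀ x y → y ≡ y + (x - y) * (0ℚ + 0ℚ)
  triple-value = solve-∀ ℚ-ring

-- With n = 3 + m and r = 3 + k: c₁ = C(n-1,r-1), c₂ = C(n-2,r-2), c₃ = C(n-3,r-3), κ = C(r,2).
module HeavyCliques (m k : ℕ) (t δ : ℚ) (w : Fin (3 ℕ.+ m) → Fin (3 ℕ.+ m) → ℚ) (v : Fin (3 ℕ.+ m)) where

  n r c₁ c₂ c₃ κ : ℕ
  n  = 3 ℕ.+ m
  r  = 3 ℕ.+ k
  c₁ = (2 ℕ.+ m) C (2 ℕ.+ k)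
  c₂ = (1 ℕ.+ m) C (1 ℕ.+ k)
  c₃ = m C k
  κ  = r C 2

  N R M C₂ C₃ K : ℚ
  N  = ℕtoℚ n
  R  = ℕtoℚ r
  M  = ℕtoℚ c₁
  C₂ = ℕtoℚ c₂
  C₃ = ℕtoℚ c₃
  K  = ℕtoℚ κ

  isHeavy : Subset n → Bool
  isHeavy S = does (t * K ℚ.≤? cliqueWeight w S)

  heavy𝟙 light𝟙 : Subset n → ℚ
  heavy𝟙 S = 𝟙 (isCliqueAt r v S ∧ isHeavy S)
  light𝟙 S = 𝟙 (isCliqueAt r v S ∧ not (isHeavy S))

  heavy light weightSum : ℚ
  heavy     = sumSubsets n heavy𝟙
  light     = sumSubsets n light𝟙
  weightSum = cliqueWeightSum r v w

  numHeavyCliquesAt≡heavy : ℕtoℚ (numHeavyCliquesAt n r t w v) ≡ heavy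
  numHeavyCliquesAt≡heavy = trans (length-filter-allSubsets n (heavyCliqueAt? r t w v))
    (sumSubsets-cong n (λ S → cong 𝟙 (sym (𝔹.∧-assoc (does (∣ S ∣ ℕ.≟ r)) (does (v ∈? S)) (isHeavy S)))))

  M≡heavy+light : M ≡ heavy + light
  M≡heavy+light = begin
    M                                                        ≡⟨ sumSubsets-𝟙-isCliqueAt (2 ℕ.+ k) v ⟨
    sumSubsets n (𝟙 ∘ isCliqueAt r v)                        ≡⟨ sumSubsets-cong n (λ S → 𝟙-split (isCliqueAt r v S) (isHeavy S)) ⟩
    sumSubsets n (λ S → heavy𝟙 S + light𝟙 S)                ≡⟨ sumSubsets-+ n heavy𝟙 light𝟙 ⟩
    heavy + light                                            ∎
    where open ≡-Reasoning

  weightSum-upper : InUnitInterval w → weightSum ≤ K * heavy + (t * K) * light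
  weightSum-upper w-unit = begin
    weightSum
      ≤⟨ sumSubsets-mono-≤ n (λ S → 𝟙*-≤-split (∣ S ∣ ℕ.≟ r) (does (v ∈? S)) (t * K ℚ.≤? cliqueWeight w S)
                                      (cliqueWeight≤K S) (ℚ.<⇒≤ ∘ ℚ.≰⇒>)) ⟩
    sumSubsets n (λ S → K * heavy𝟙 S + (t * K) * light𝟙 S)
      ≡⟨ sumSubsets-+ n (λ S → K * heavy𝟙 S) (λ S → (t * K) * light𝟙 S) ⟩
    sumSubsets n (λ S → K * heavy𝟙 S) + sumSubsets n (λ S → (t * K) * light𝟙 S)
      ≡⟨ cong₂ _+_ (sumSubsets-*ˡ n K heavy𝟙) (sumSubsets-*ˡ n (t * K) light𝟙) ⟩
    K * heavy + (t * K) * light ∎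
    where
    open ℚ.≤-Reasoning
    cliqueWeight≤K : ∀ S → ∣ S ∣ ≡ r → cliqueWeight w S ≤ K
    cliqueWeight≤K S ∣S∣≡r = subst (λ s → cliqueWeight w S ≤ ℕtoℚ (s C 2)) ∣S∣≡r (cliqueWeight-≤ w-unit S)

  weightSum-double : Symmetric w → weightSum + weightSum ≡ C₃ * sumFin (wdeg w) + (C₂ - C₃) * (wdeg w v + wdeg w v)
  weightSum-double w-sym = begin
    weightSum + weightSum
      ≡⟨ cliqueWeightSum-double r v w-sym ⟩
    sumFin (λ i → sumFin (λ j → offDiag w i j * #supersets n (⁅ v ⁆ ∪ (⁅ i ⁆ ∪ ⁅ j ⁆)) r))
      ≡⟨ sumFin-cong (λ i → sumFin-cong (λ j → offDiag-*-cong w i j (#supersets-triple m k v i j))) ⟩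
    sumFin (λ i → sumFin (λ j → offDiag w i j * (C₃ + (C₂ - C₃) * (𝟙 (does (i Fin.≟ v)) + 𝟙 (does (j Fin.≟ v))))))
      ≡⟨ sumFin²-offDiag-at w-sym v C₃ (C₂ - C₃) ⟩
    C₃ * sumFin (wdeg w) + (C₂ - C₃) * (wdeg w v + wdeg w v) ∎
    where open ≡-Reasoning

  degreeCount-identity-ℚ : N * (N * C₃ + (C₂ + C₂)) ≡ (K * M + K * M) + R * C₂ + N * (C₃ + C₃)
  degreeCount-identity-ℚ = begin
    N * (N * C₃ + (C₂ + C₂))
      ≡⟨ trans (ℕtoℚ-* n (n ℕ.* c₃ ℕ.+ (c₂ ℕ.+ c₂))) (cong (N *_) (trans (ℕtoℚ-+ (n ℕ.* c₃) (c₂ ℕ.+ c₂)) (cong₂ _+_ (ℕtoℚ-* n c₃) (ℕtoℚ-+ c₂ c₂)))) ⟨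
    ℕtoℚ (n ℕ.* (n ℕ.* c₃ ℕ.+ (c₂ ℕ.+ c₂)))
      ≡⟨ cong ℕtoℚ (degreeCount-identity m k c₁ c₂ c₃ κ
                      ([k+1]*[n+1]C[k+1]≡[n+1]*nCk m k)
                      ([k+1]*[n+1]C[k+1]≡[n+1]*nCk (1 ℕ.+ m) (1 ℕ.+ k))
                      (trans ([k+1]*[n+1]C[k+1]≡[n+1]*nCk (2 ℕ.+ k) 1) (cong (r ℕ.*_) (nC1≡n (2 ℕ.+ k))))) ⟩
    ℕtoℚ ((κ ℕ.* c₁ ℕ.+ κ ℕ.* c₁) ℕ.+ r ℕ.* c₂ ℕ.+ n ℕ.* (c₃ ℕ.+ c₃))
      ≡⟨ trans (ℕtoℚ-+ (κ ℕ.* c₁ ℕ.+ κ ℕ.* c₁ ℕ.+ r ℕ.* c₂) (n ℕ.* (c₃ ℕ.+ c₃)))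
               (cong₂ _+_ (trans (ℕtoℚ-+ (κ ℕ.* c₁ ℕ.+ κ ℕ.* c₁) (r ℕ.* c₂))
                                 (cong₂ _+_ (trans (ℕtoℚ-+ (κ ℕ.* c₁) (κ ℕ.* c₁)) (cong₂ _+_ (ℕtoℚ-* κ c₁) (ℕtoℚ-* κ c₁)))
                                            (ℕtoℚ-* r c₂)))
                          (trans (ℕtoℚ-* n (c₃ ℕ.+ c₃)) (cong (N *_) (ℕtoℚ-+ c₃ c₃)))) ⟩
    (K * M + K * M) + R * C₂ + N * (C₃ + C₃) ∎
    where open ≡-Reasoning

  degreeBound-identity : C₃ * (N * (δ * N)) + (C₂ - C₃) * (δ * N + δ * N) ≡ (δ * K * M + δ * K * M) + δ * R * C₂
  degreeBound-identity = begin
    C₃ * (N * (δ * N)) + (C₂ - C₃) * (δ * N + δ * N)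
      ≡⟨ factor-δN δ N C₂ C₃ ⟩
    δ * (N * (N * C₃ + (C₂ + C₂)) - N * (C₃ + C₃))
      ≡⟨ cong (λ x → δ * (x - N * (C₃ + C₃))) degreeCount-identity-ℚ ⟩
    δ * ((K * M + K * M) + R * C₂ + N * (C₃ + C₃) - N * (C₃ + C₃))
      ≡⟨ cancel δ K M R C₂ (N * (C₃ + C₃)) ⟩
    (δ * K * M + δ * K * M) + δ * R * C₂ ∎
    where
    open ≡-Reasoning
    factor-δN : ∀ δ N C₂ C₃ → C₃ * (N * (δ * N)) + (C₂ - C₃) * (δ * N + δ * N) ≡ δ * (N * (N * C₃ + (C₂ + C₂)) - N * (C₃ + C₃))
    factor-δN = solve-∀ ℚ-ring
    cancel : ∀ δ K M R C₂ x → δ * ((K * M + K * M) + R * C₂ + x - x) ≡ (δ * K * M + δ * K * M) + δ * R * C₂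
    cancel = solve-∀ ℚ-ring

  weightSum-lower : Symmetric w → 0ℚ ≤ δ → (∀ u → δ * N ≤ wdeg w u) → δ * K * M ≤ weightSum
  weightSum-lower w-sym 0≤δ deg = p+p≤q+q⇒p≤q (begin
    δ * K * M + δ * K * M
      ≤⟨ 0≤q⇒p≤p+q (0≤p*q (0≤p*q 0≤δ (ℕtoℚ-nonNeg r)) (ℕtoℚ-nonNeg c₂)) ⟩
    (δ * K * M + δ * K * M) + δ * R * C₂
      ≡⟨ degreeBound-identity ⟨
    C₃ * (N * (δ * N)) + (C₂ - C₃) * (δ * N + δ * N)
      ≤⟨ ℚ.+-mono-≤ (ℚ.*-monoˡ-≤-nonNeg C₃ {{ℚ.nonNegative (ℕtoℚ-nonNeg c₃)}} degreeSum-lower)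
                    (ℚ.*-monoˡ-≤-nonNeg (C₂ - C₃) {{ℚ.nonNegative (p≤q⇒0≤q-p (ℕtoℚ-mono-≤ (nCk≤[n+1]C[k+1] m k)))}}
                                        (ℚ.+-mono-≤ (deg v) (deg v))) ⟩
    C₃ * sumFin (wdeg w) + (C₂ - C₃) * (wdeg w v + wdeg w v)
      ≡⟨ weightSum-double w-sym ⟨
    weightSum + weightSum ∎)
    where
    open ℚ.≤-Reasoning
    degreeSum-lower : N * (δ * N) ≤ sumFin (wdeg w)
    degreeSum-lower = subst (_≤ sumFin (wdeg w)) (sumFin-const n (δ * N)) (sumFin-mono-≤ deg)

  0<K : 0ℚ < K
  0<K = ℚ.<-≤-trans (ℚ.positive⁻¹ 1ℚ) (ℕtoℚ-mono-≤ {1} {κ}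
          (ℕ.≤-trans (subst (1 ℕ.≤_) (sym (nC1≡n (2 ℕ.+ k))) (s≤s z≤n)) (nCk≤[n+1]C[k+1] (2 ℕ.+ k) 1)))

  heavy-light-bound : Symmetric w → InUnitInterval w → 0ℚ ≤ t → (∀ u → δ * N ≤ wdeg w u) →
    δ * (heavy + light) ≤ heavy + t * light
  heavy-light-bound w-sym w-unit 0≤t deg = bySign (0ℚ ℚ.≤? δ)
    where
    0≤heavy : 0ℚ ≤ heavy
    0≤heavy = sumSubsets-𝟙-nonNeg n (λ S → isCliqueAt r v S ∧ isHeavy S)
    0≤light : 0ℚ ≤ light
    0≤light = sumSubsets-𝟙-nonNeg n (λ S → isCliqueAt r v S ∧ not (isHeavy S))
    reassoc : ∀ K δ M → K * (δ * M) ≡ δ * K * M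
    reassoc = solve-∀ ℚ-ring
    distrib : ∀ K t h l → K * h + (t * K) * l ≡ K * (h + t * l)
    distrib = solve-∀ ℚ-ring
    bySign : Dec (0ℚ ≤ δ) → δ * (heavy + light) ≤ heavy + t * light
    bySign (yes 0≤δ) = ℚ.*-cancelˡ-≤-pos K {{ℚ.positive 0<K}} (begin
      K * (δ * (heavy + light))   ≡⟨ cong (λ x → K * (δ * x)) M≡heavy+light ⟨
      K * (δ * M)                 ≡⟨ reassoc K δ M ⟩
      δ * K * M                   ≤⟨ weightSum-lower w-sym 0≤δ deg ⟩
      weightSum                   ≤⟨ weightSum-upper w-unit ⟩
      K * heavy + (t * K) * light ≡⟨ distrib K t heavy light ⟩
      K * (heavy + t * light)     ∎)
      where open ℚ.≤-Reasoning
    bySign (no 0≰δ) = begin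
      δ * (heavy + light)   ≤⟨ ℚ.*-monoʳ-≤-nonNeg (heavy + light) {{ℚ.nonNegative (ℚ.+-mono-≤ 0≤heavy 0≤light)}}
                                                  (ℚ.<⇒≤ (ℚ.≰⇒> 0≰δ)) ⟩
      0ℚ * (heavy + light)  ≡⟨ ℚ.*-zeroˡ (heavy + light) ⟩
      0ℚ                    ≤⟨ ℚ.+-mono-≤ 0≤heavy (0≤p*q 0≤t 0≤light) ⟩
      heavy + t * light     ∎
      where open ℚ.≤-Reasoning

lemma5 : (r : ℕ) → 3 Data.Nat.≤ r → (t δ : ℚ) → 0ℚ ≤ t → (t<1 : t < 1ℚ) →
         (n : ℕ) → (w : Fin n → Fin n → ℚ) → Symmetric w → InUnitInterval w →
         (∀ v → δ * ℕtoℚ n ≤ wdeg w v) →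
         ∀ v → factor t δ t<1 * ℕtoℚ ((n ∸ 1) C (r ∸ 1)) ≤ ℕtoℚ (numHeavyCliquesAt n r t w v)
lemma5 (suc (suc (suc k))) (s≤s (s≤s (s≤s z≤n))) t δ 0≤t t<1 (suc (suc (suc m))) w w-sym w-unit deg v =
  subst₂ _≤_ (cong (factor t δ t<1 *_) (sym M≡heavy+light)) (sym numHeavyCliquesAt≡heavy)
    (factor*-≤ {t} {δ} {heavy} {light} t<1 (heavy-light-bound w-sym w-unit 0≤t deg))
  where open HeavyCliques m k t δ w v
-- For n ∈ {1, 2} we have n - 1 < r - 1, so the binomial coefficient on the left vanishes.
lemma5 (suc (suc (suc k))) _ t δ _ t<1 1 w _ _ _ v = p*0≤ℕtoℚ (factor t δ t<1) (numHeavyCliquesAt 1 (3 ℕ.+ k) t w v)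
lemma5 (suc (suc (suc k))) _ t δ _ t<1 2 w _ _ _ v = p*0≤ℕtoℚ (factor t δ t<1) (numHeavyCliquesAt 2 (3 ℕ.+ k) t w v)
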